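{- For all $n\geq 1$ and $\sigma\in\{132,231\}$, the number of desarrangements of length $n$ avoiding both $312$ and $\sigma$ is $d_n(312,\sigma)=J_{n-1}$, the $(n-1)$st Jacobsthal number.
   Context: Permutations are in one-line notation. An index $i\in[n-1]$ is a descent of $\pi\in\mathfrak{S}_n$ if $\pi_i>\pi_{i+1}$; $i\in[n]$ is an ascent if it is not a descent (so $n$ is always an ascent). A desarrangement is a permutation whose first ascent is even. $d_n(\Pi)$ is the number of desarrangements in $\mathfrak{S}_n$ avoiding every pattern in $\Pi$ ($\pi$ avoids $\sigma$ if no subsequence of $\pi$ has the same relative order as $\sigma$). The Jacobsthal numbers are defined by $J_0=0$, $J_1=1$, $J_n=J_{n-1}+2J_{n-2}$ for $n\ge2$. -}

module Defs where

open import Data.Nat using (ℕ; zero; suc; _+_; _*_; _<_; _<ᵇ_)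
open import Data.Nat.Properties using (_<?_)
open import Data.Bool using (Bool; true; false; if_then_else_)
open import Data.Fin using (Fin; toℕ)
open import Data.Vec using (Vec; []; _∷_; toList)
open import Data.List using (List; []; _∷_; length; filter; map; concatMap; allFin; lookup; zip; _++_)
open import Data.List.Relation.Unary.Unique.Propositional using (Unique)
open import Data.List.Relation.Unary.Any using (Any)
open import Data.Product using (_×_; proj₁; proj₂)
open import Relation.Nullary using (¬_; Dec)
open import Relation.Unary using (Pred)
open import Data.List.Relation.Unary.All using (All; all?)
open import Relation.Binary.PropositionalEquality using (_≡_)
open import Function.Bundles using (_⇔_)

jacobsthal : ℕ → ℕ
jacobsthal zero = 0
jacobsthal (suc zero) = 1
jacobsthal (suc (suc n)) = jacobsthal (suc n) + 2 * jacobsthal n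

words : (n k : ℕ) → List (Vec (Fin n) k)
words n zero = [] ∷ []
words n (suc k) = concatMap (λ x → map (x ∷_) (words n k)) (allFin n)

-- one-line notation: a word w ∈ [n]^n (values 0..n-1) is a permutation of length n
-- iff its entries are pairwise distinct
IsPerm : ∀ {n} → Vec (Fin n) n → Set
IsPerm w = Unique (toList w)

subseqs : List ℕ → List (List ℕ)
subseqs [] = [] ∷ []
subseqs (x ∷ xs) = map (x ∷_) (subseqs xs) ++ subseqs xs

SameOrder : List ℕ → List ℕ → Set
SameOrder xs ys = (length xs ≡ length ys) × OrderAgree (zip xs ys)
  where
    OrderAgree : List (ℕ × ℕ) → Set
    OrderAgree ps = ∀ (i j : Fin (length ps)) →
      (proj₁ (lookup ps i) < proj₁ (lookup ps j)) ⇔ (proj₂ (lookup ps i) < proj₂ (lookup ps j))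

Contains : List ℕ → List ℕ → Set
Contains π σ = Any (λ s → SameOrder s σ) (subseqs π)

Avoids : List ℕ → List ℕ → Set
Avoids π σ = ¬ Contains π σ

-- first ascent (1-indexed) of a list: least i with π_i < π_{i+1}, or i = length π
firstAscent : List ℕ → ℕ
firstAscent [] = 0
firstAscent (x ∷ []) = 1
firstAscent (x ∷ y ∷ ys) = if x <ᵇ y then 1 else suc (firstAscent (y ∷ ys))

data Even : ℕ → Set where
  even0 : Even zero
  even+2 : ∀ {n} → Even n → Even (suc (suc n))

IsDesarrangement : List ℕ → Set
IsDesarrangement π = Even (firstAscent π)

oneLine : ∀ {n} → Vec (Fin n) n → List ℕ
oneLine w = map toℕ (toList w)

open import Relation.Nullary.Decidable using (yes; no; _×-dec_; _→-dec_; ¬?; map′)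
open import Data.Nat using (_≟_)
import Data.List.Relation.Unary.Unique.DecSetoid as UDS
import Data.Fin.Properties as FinP
open import Data.List.Relation.Unary.Any using (any?)
open import Function.Bundles using (mk⇔; Equivalence)
open import Relation.Binary.PropositionalEquality using (refl)

even? : (n : ℕ) → Dec (Even n)
even? zero = yes even0
even? (suc zero) = no (λ ())
even? (suc (suc n)) with even? n
... | yes p = yes (even+2 p)
... | no ¬p = no (λ { (even+2 p) → ¬p p })

⇔-dec : {A B : Set} → Dec A → Dec B → Dec (A ⇔ B)
⇔-dec a b = map′ (λ (f , g) → mk⇔ f g) (λ e → Equivalence.to e , Equivalence.from e) ((a →-dec b) ×-dec (b →-dec a))
  where open import Data.Product using (_,_)

sameOrder? : (xs ys : List ℕ) → Dec (SameOrder xs ys)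
sameOrder? xs ys = (length xs ≟ length ys) ×-dec
  FinP.all? (λ i → FinP.all? (λ j → ⇔-dec (_ <? _) (_ <? _)))

avoids? : (π σ : List ℕ) → Dec (Avoids π σ)
avoids? π σ = ¬? (any? (λ s → sameOrder? s σ) (subseqs π))

isPerm? : ∀ {n} (w : Vec (Fin n) n) → Dec (IsPerm w)
isPerm? {n} w = UDS.unique? (FinP.≡-decSetoid n) (toList w)

Good : (n : ℕ) → List (List ℕ) → Vec (Fin n) n → Set
Good n Π w = IsPerm w × IsDesarrangement (oneLine w) × All (Avoids (oneLine w)) Π

good? : (n : ℕ) (Π : List (List ℕ)) (w : Vec (Fin n) n) → Dec (Good n Π w)
good? n Π w = isPerm? w ×-dec even? (firstAscent (oneLine w)) ×-dec all? (avoids? (oneLine w)) Π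

d : ℕ → List (List ℕ) → ℕ
d n Π = length (filter (good? n Π) (words n n))

-- A permutation avoiding 312 and 132 is one whose every entry is a new maximum or a
-- new minimum of the entries before it; one avoiding 312 and 231 is a concatenation
-- of decreasing runs of consecutive values, each run lying above the previous one.
-- In both classes a permutation of length n + 1 is determined by its ascent word in
-- {ascent, descent}ⁿ, and every word occurs.  The first ascent is one more than the
-- number of leading descents, so desarrangements correspond to words whose leading
-- run of descents has odd length.  Such words of length m + 2 start either with a
-- descent and an ascent (2ᵐ of them) or with two descents followed by such a word of
-- length m; as J (m + 1) + J m = 2ᵐ, this is the Jacobsthal recurrence.

module Submission where

open import Defs
open import Data.Bool using (Bool; true; false; T)
open import Data.Empty using (⊥-elim)
open import Data.Fin as Fin using (Fin; toℕ)
open import Data.Fin.Patterns using (0F; 1F; 2F)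
open import Data.Fin.Properties using (toℕ-injective; toℕ<n; toℕ-fromℕ<)
import Data.List as List
open import Data.List
  using (List; []; _∷_; length; map; filter; _++_; [_]; replicate; concatMap; allFin; upTo; cartesianProductWith)
open import Data.List.Properties using (∷-injectiveʳ; length-map; length-++; length-upTo; ++-assoc; ++-identityʳ)
open import Data.List.Membership.Propositional using (_∈_; _∉_)
open import Data.List.Membership.Propositional.Properties
open import Data.List.Relation.Binary.Sublist.Propositional
  using (_⊆_; []; _∷_; _∷ʳ_; ⊆-refl; ⊆-trans; lookup; from∈; to∈)
import Data.List.Relation.Binary.Sublist.Propositional.Properties as Sublist
open import Data.List.Relation.Unary.All using (All; []; _∷_)
import Data.List.Relation.Unary.All as All
import Data.List.Relation.Unary.All.Properties as All
open import Data.List.Relation.Unary.AllPairs using ([]; _∷_)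
open import Data.List.Relation.Unary.Any using (Any; here; there)
import Data.List.Relation.Unary.Any.Properties as Any
open import Data.List.Relation.Unary.Unique.Propositional using (Unique)
import Data.List.Relation.Unary.Unique.Propositional.Properties as Unique
open import Data.Nat using (ℕ; zero; suc; _+_; _*_; _^_; _∸_; _≤_; _<_; z≤n; s≤s; z<s; s<s; _<ᵇ_)
open import Data.Nat.DivMod using (_mod_; m<n⇒m%n≡m)
open import Data.Nat.Properties
open import Data.Nat.Tactic.RingSolver using (solve-∀)
open import Data.List.Membership.DecPropositional _≟_ using (_∈?_)
open import Data.Product using (∃; _×_; _,_; proj₁; proj₂)
open import Data.Sum using (_⊎_; inj₁; inj₂)
open import Data.Vec using (Vec; []; _∷_; toList)
import Data.Vec.Properties as Vec
open import Function.Bundles using (_⇔_; mk⇔; Equivalence)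
open import Relation.Binary using (tri<; tri≈; tri>)
open import Relation.Binary.PropositionalEquality hiding ([_])
open import Relation.Nullary using (¬_; yes; no)
open import Relation.Unary using (Decidable)

module _ {A : Set} where

  private
    ∈-remove : ∀ (us : List A) {vs x z} → z ∈ us ++ x ∷ vs → z ≢ x → z ∈ us ++ vs
    ∈-remove []       (here refl) z≢x = ⊥-elim (z≢x refl)
    ∈-remove []       (there z∈)  _   = z∈
    ∈-remove (u ∷ us) (here refl) _   = here refl
    ∈-remove (u ∷ us) (there z∈)  z≢x = there (∈-remove us z∈ z≢x)

  Unique⊆⇒length≤ : {xs ys : List A} → Unique xs → (∀ {z} → z ∈ xs → z ∈ ys) → length xs ≤ length ys
  Unique⊆⇒length≤ {[]}     _             _   = z≤n
  Unique⊆⇒length≤ {x ∷ xs} {ys} (x∉xs ∷ xs!) xs⊆ys with ∈-∃++ (xs⊆ys (here refl))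
  ... | us , vs , refl = begin
    suc (length xs)              ≤⟨ s≤s (Unique⊆⇒length≤ xs! xs⊆us++vs) ⟩
    suc (length (us ++ vs))      ≡⟨ cong suc (length-++ us) ⟩
    suc (length us + length vs)  ≡⟨ +-suc (length us) (length vs) ⟨
    length us + suc (length vs)  ≡⟨ length-++ us ⟨
    length (us ++ x ∷ vs)        ∎
    where
    open ≤-Reasoning
    xs⊆us++vs : ∀ {z} → z ∈ xs → z ∈ us ++ vs
    xs⊆us++vs z∈xs = ∈-remove us (xs⊆ys (there z∈xs)) (λ z≡x → All.lookup x∉xs z∈xs (sym z≡x))

  Unique-++⁻ : ∀ (xs : List A) {ys} → Unique (xs ++ ys) → Unique ys × (∀ {v} → v ∈ ys → v ∉ xs)
  Unique-++⁻ []       ys!            = ys! , λ _ ()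
  Unique-++⁻ (x ∷ xs) (x∉ ∷ xs++ys!) = proj₁ (Unique-++⁻ xs xs++ys!) , λ where
    v∈ys (here refl)  → All.lookup x∉ (∈-++⁺ʳ xs v∈ys) refl
    v∈ys (there v∈xs) → proj₂ (Unique-++⁻ xs xs++ys!) v∈ys v∈xs

  ∈-++-∷⁻ : ∀ (p : List A) {y s v} → v ∈ p ++ y ∷ s → v ∉ p → v ≢ y → v ∈ s
  ∈-++-∷⁻ p v∈ v∉p v≢y with ∈-++⁻ p v∈
  ... | inj₁ v∈p         = ⊥-elim (v∉p v∈p)
  ... | inj₂ (here v≡y)  = ⊥-elim (v≢y v≡y)
  ... | inj₂ (there v∈s) = v∈s

  ∈-∈-⊆ : ∀ {p s : List A} {a y c} → a ∈ p → c ∈ s → a ∷ y ∷ c ∷ [] ⊆ p ++ y ∷ s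
  ∈-∈-⊆ a∈p c∈s = Sublist.++⁺ (from∈ a∈p) (refl ∷ from∈ c∈s)

  ⊆-++-split : ∀ (xs : List A) {ys zs} → zs ⊆ xs ++ ys →
    ∃ λ z₁ → ∃ λ z₂ → zs ≡ z₁ ++ z₂ × z₁ ⊆ xs × z₂ ⊆ ys
  ⊆-++-split []       τ          = [] , _ , refl , [] , τ
  ⊆-++-split (x ∷ xs) (_ ∷ʳ τ)   with ⊆-++-split xs τ
  ... | z₁ , z₂ , refl , τ₁ , τ₂ = z₁ , z₂ , refl , x ∷ʳ τ₁ , τ₂
  ⊆-++-split (x ∷ xs) (refl ∷ τ) with ⊆-++-split xs τ
  ... | z₁ , z₂ , refl , τ₁ , τ₂ = x ∷ z₁ , z₂ , refl , refl ∷ τ₁ , τ₂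

length≤-by-retraction : {A B : Set} {xs : List A} {ys : List B} (s : A → B) (r : B → A) → Unique xs →
  (∀ {x} → x ∈ xs → s x ∈ ys) → (∀ {x} → x ∈ xs → r (s x) ≡ x) → length xs ≤ length ys
length≤-by-retraction {xs = xs} {ys} s r xs! into retract = begin
  length xs          ≤⟨ Unique⊆⇒length≤ xs! (λ x∈ → subst (_∈ map r ys) (retract x∈) (∈-map⁺ r (into x∈))) ⟩
  length (map r ys)  ≡⟨ length-map r ys ⟩
  length ys          ∎
  where open ≤-Reasoning

length-filter≡-by-bijection : {A B : Set} {P : A → Set} (P? : Decidable P) {W : List A} {C : List B} →
  Unique W → (∀ a → a ∈ W) → Unique C → (f : B → A) (g : A → B) →
  (∀ {c} → c ∈ C → P (f c)) → (∀ {c} → c ∈ C → g (f c) ≡ c) →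
  (∀ {a} → P a → g a ∈ C) → (∀ {a} → P a → f (g a) ≡ a) →
  length (filter P? W) ≡ length C
length-filter≡-by-bijection {P = P} P? {W} W! W-complete C! f g f-into g∘f g-into f∘g = ≤-antisym
  (length≤-by-retraction g f (Unique.filter⁺ P? W!) (λ a∈ → g-into (satisfies a∈)) (λ a∈ → f∘g (satisfies a∈)))
  (length≤-by-retraction f g C! (λ c∈ → ∈-filter⁺ P? (W-complete _) (f-into c∈)) g∘f)
  where
  satisfies : ∀ {a} → a ∈ filter P? W → P a
  satisfies a∈ = proj₂ (∈-filter⁻ P? {xs = W} a∈)

words≡cartesianProduct : ∀ {n k} (xs : List (Fin n)) →
  concatMap (λ x → map (x ∷_) (words n k)) xs ≡ cartesianProductWith _∷_ xs (words n k)
words≡cartesianProduct []       = refl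
words≡cartesianProduct {n} {k} (x ∷ xs) = cong (map (x ∷_) (words n k) ++_) (words≡cartesianProduct xs)

∈-words : ∀ {n} k (w : Vec (Fin n) k) → w ∈ words n k
∈-words zero    []      = here refl
∈-words {n} (suc k) (x ∷ w) = subst (x ∷ w ∈_) (sym (words≡cartesianProduct (allFin n)))
  (∈-cartesianProductWith⁺ _∷_ (∈-allFin x) (∈-words k w))

words-Unique : ∀ n k → Unique (words n k)
words-Unique n zero    = [] ∷ []
words-Unique n (suc k) = subst Unique (sym (words≡cartesianProduct (allFin n)))
  (Unique.cartesianProductWith⁺ _∷_ Vec.∷-injective (Unique.allFin⁺ n) (words-Unique n k))

-- Inverse of oneLine on lists of length k with entries below suc m; other lists give junk.
module _ {m : ℕ} where

  vecOf : ∀ k → List ℕ → Vec (Fin (suc m)) k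
  vecOf zero    _        = []
  vecOf (suc k) []       = Fin.zero ∷ vecOf k []
  vecOf (suc k) (x ∷ xs) = x mod suc m ∷ vecOf k xs

  toℕ-mod : ∀ {x} → x < suc m → toℕ (x mod suc m) ≡ x
  toℕ-mod x<m = trans (toℕ-fromℕ< _) (m<n⇒m%n≡m x<m)

  oneLine-vecOf : ∀ k (xs : List ℕ) → length xs ≡ k → All (_< suc m) xs → map toℕ (toList (vecOf k xs)) ≡ xs
  oneLine-vecOf zero    []       _   _            = refl
  oneLine-vecOf (suc k) (x ∷ xs) len (x<m ∷ xs<m) = cong₂ _∷_ (toℕ-mod x<m) (oneLine-vecOf k xs (suc-injective len) xs<m)

  vecOf-oneLine : ∀ {k} (w : Vec (Fin (suc m)) k) → vecOf k (map toℕ (toList w)) ≡ w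
  vecOf-oneLine []      = refl
  vecOf-oneLine (i ∷ w) = cong₂ _∷_ (toℕ-injective (toℕ-mod (toℕ<n i))) (vecOf-oneLine w)

ascentWord : List ℕ → List Bool
ascentWord (x ∷ y ∷ r) = (x <ᵇ y) ∷ ascentWord (y ∷ r)
ascentWord _           = []

leadingDescents : List Bool → ℕ
leadingDescents []          = 0
leadingDescents (true ∷ w)  = 0
leadingDescents (false ∷ w) = suc (leadingDescents w)

firstAscent≡suc-leadingDescents : ∀ x r → firstAscent (x ∷ r) ≡ suc (leadingDescents (ascentWord (x ∷ r)))
firstAscent≡suc-leadingDescents x []      = refl
firstAscent≡suc-leadingDescents x (y ∷ r) with x <ᵇ y
... | true  = refl
... | false = cong suc (firstAscent≡suc-leadingDescents y r)

length-ascentWord : ∀ π → length (ascentWord π) ≡ length π ∸ 1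
length-ascentWord []          = refl
length-ascentWord (x ∷ [])    = refl
length-ascentWord (x ∷ y ∷ r) = cong suc (length-ascentWord (y ∷ r))

<⇒<ᵇ≡true : ∀ {a b} → a < b → (a <ᵇ b) ≡ true
<⇒<ᵇ≡true {a} {b} a<b with a <ᵇ b | <⇒<ᵇ a<b
... | true | _ = refl

≤⇒<ᵇ≡false : ∀ {a b} → b ≤ a → (a <ᵇ b) ≡ false
≤⇒<ᵇ≡false {a} {b} b≤a with a <ᵇ b in eq
... | false = refl
... | true  = ⊥-elim (<⇒≱ (<ᵇ⇒< a b (subst T (sym eq) _)) b≤a)

OddLeadingDescents EvenLeadingDescents : List Bool → Set
OddLeadingDescents w  = Even (suc (leadingDescents w))
EvenLeadingDescents w = Even (leadingDescents w)

desarrangement⇔odd : ∀ {π} → 0 < length π → IsDesarrangement π ⇔ OddLeadingDescents (ascentWord π)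
desarrangement⇔odd {x ∷ r} _ =
  mk⇔ (subst Even (firstAscent≡suc-leadingDescents x r)) (subst Even (sym (firstAscent≡suc-leadingDescents x r)))

tagged : List (List Bool) → List (List Bool) → List (List Bool)
tagged xs ys = map (true ∷_) xs ++ map (false ∷_) ys

bitWords : ℕ → List (List Bool)
bitWords zero    = [ [] ]
bitWords (suc m) = tagged (bitWords m) (bitWords m)

oddWords evenWords : ℕ → List (List Bool)
oddWords zero     = []
oddWords (suc m)  = map (false ∷_) (evenWords m)
evenWords zero    = [ [] ]
evenWords (suc m) = tagged (bitWords m) (oddWords m)

length-tagged : ∀ xs ys → length (tagged xs ys) ≡ length xs + length ys
length-tagged xs ys = trans (length-++ (map (true ∷_) xs)) (cong₂ _+_ (length-map _ xs) (length-map _ ys))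

tagged-Unique : ∀ {xs ys} → Unique xs → Unique ys → Unique (tagged xs ys)
tagged-Unique xs! ys! = Unique.++⁺ (Unique.map⁺ ∷-injectiveʳ xs!) (Unique.map⁺ ∷-injectiveʳ ys!) heads-differ
  where
  heads-differ : ∀ {w xs ys} → ¬ (w ∈ map (true ∷_) xs × w ∈ map (false ∷_) ys)
  heads-differ (w∈ , w∈′) with map∷⁻ w∈ | map∷⁻ w∈′
  ... | _ , _ , refl | _ , _ , ()

length-bitWords : ∀ m → length (bitWords m) ≡ 2 ^ m
length-bitWords zero    = refl
length-bitWords (suc m) = begin
  length (tagged (bitWords m) (bitWords m))  ≡⟨ length-tagged (bitWords m) (bitWords m) ⟩
  length (bitWords m) + length (bitWords m)  ≡⟨ cong₂ _+_ (length-bitWords m) (length-bitWords m) ⟩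
  2 ^ m + 2 ^ m                              ≡⟨ cong (2 ^ m +_) (+-identityʳ (2 ^ m)) ⟨
  2 ^ suc m                                  ∎
  where open ≡-Reasoning

jacobsthal-suc+jacobsthal : ∀ m → jacobsthal (suc m) + jacobsthal m ≡ 2 ^ m
jacobsthal-suc+jacobsthal zero    = refl
jacobsthal-suc+jacobsthal (suc m) = begin
  (jacobsthal (suc m) + 2 * jacobsthal m) + jacobsthal (suc m)  ≡⟨ regroup (jacobsthal (suc m)) (jacobsthal m) ⟩
  2 * (jacobsthal (suc m) + jacobsthal m)                       ≡⟨ cong (2 *_) (jacobsthal-suc+jacobsthal m) ⟩
  2 ^ suc m                                                     ∎
  where
  open ≡-Reasoning
  regroup : ∀ a b → (a + 2 * b) + a ≡ 2 * (a + b)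
  regroup = solve-∀

length-oddWords : ∀ m → length (oddWords m) ≡ jacobsthal m
length-oddWords zero          = refl
length-oddWords (suc zero)    = refl
length-oddWords (suc (suc m)) = begin
  length (map (false ∷_) (evenWords (suc m)))          ≡⟨ length-map _ (evenWords (suc m)) ⟩
  length (tagged (bitWords m) (oddWords m))            ≡⟨ length-tagged (bitWords m) (oddWords m) ⟩
  length (bitWords m) + length (oddWords m)            ≡⟨ cong₂ _+_ (length-bitWords m) (length-oddWords m) ⟩
  2 ^ m + jacobsthal m                                 ≡⟨ cong (_+ jacobsthal m) (jacobsthal-suc+jacobsthal m) ⟨
  jacobsthal (suc m) + jacobsthal m + jacobsthal m     ≡⟨ +-assoc (jacobsthal (suc m)) (jacobsthal m) (jacobsthal m) ⟩
  jacobsthal (suc m) + (jacobsthal m + jacobsthal m)   ≡⟨ cong (λ z → jacobsthal (suc m) + (jacobsthal m + z)) (+-identityʳ _) ⟨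
  jacobsthal (suc (suc m))                             ∎
  where open ≡-Reasoning

bitWords-length : ∀ m → All (λ w → length w ≡ m) (bitWords m)
bitWords-length zero    = refl ∷ []
bitWords-length (suc m) = All.++⁺ (All.map⁺ (All.map (cong suc) (bitWords-length m)))
                                  (All.map⁺ (All.map (cong suc) (bitWords-length m)))

oddWords-sound  : ∀ m → All (λ w → length w ≡ m × OddLeadingDescents w) (oddWords m)
evenWords-sound : ∀ m → All (λ w → length w ≡ m × EvenLeadingDescents w) (evenWords m)
oddWords-sound zero    = []
oddWords-sound (suc m) = All.map⁺ (All.map (λ (len , even) → cong suc len , even+2 even) (evenWords-sound m))
evenWords-sound zero    = (refl , even0) ∷ []
evenWords-sound (suc m) = All.++⁺ (All.map⁺ (All.map (λ len → cong suc len , even0) (bitWords-length m)))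
                                  (All.map⁺ (All.map (λ (len , odd) → cong suc len , odd) (oddWords-sound m)))

∈-bitWords : ∀ w → w ∈ bitWords (length w)
∈-bitWords []          = here refl
∈-bitWords (true ∷ w)  = ∈-++⁺ˡ (∈-map⁺ (true ∷_) (∈-bitWords w))
∈-bitWords (false ∷ w) = ∈-++⁺ʳ (map (true ∷_) (bitWords (length w))) (∈-map⁺ (false ∷_) (∈-bitWords w))

∈-oddWords  : ∀ w → OddLeadingDescents w → w ∈ oddWords (length w)
∈-evenWords : ∀ w → EvenLeadingDescents w → w ∈ evenWords (length w)
∈-oddWords (false ∷ w) (even+2 even) = ∈-map⁺ (false ∷_) (∈-evenWords w even)
∈-evenWords []          _   = here refl
∈-evenWords (true ∷ w)  _   = ∈-++⁺ˡ (∈-map⁺ (true ∷_) (∈-bitWords w))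
∈-evenWords (false ∷ w) odd = ∈-++⁺ʳ (map (true ∷_) (bitWords (length w))) (∈-map⁺ (false ∷_) (∈-oddWords w odd))

bitWords-Unique : ∀ m → Unique (bitWords m)
bitWords-Unique zero    = [] ∷ []
bitWords-Unique (suc m) = tagged-Unique (bitWords-Unique m) (bitWords-Unique m)

oddWords-Unique  : ∀ m → Unique (oddWords m)
evenWords-Unique : ∀ m → Unique (evenWords m)
oddWords-Unique zero     = []
oddWords-Unique (suc m)  = Unique.map⁺ ∷-injectiveʳ (evenWords-Unique m)
evenWords-Unique zero    = [] ∷ []
evenWords-Unique (suc m) = tagged-Unique (bitWords-Unique m) (oddWords-Unique m)

Any-subseqs⁻ : ∀ {P : List ℕ → Set} π → Any P (subseqs π) → ∃ λ s → s ⊆ π × P s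
Any-subseqs⁻ []       (here Ps) = [] , [] , Ps
Any-subseqs⁻ (x ∷ xs) any with Any.++⁻ (map (x ∷_) (subseqs xs)) any
... | inj₁ kept    = let s , s⊆xs , Ps = Any-subseqs⁻ xs (Any.map⁻ kept) in x ∷ s , refl ∷ s⊆xs , Ps
... | inj₂ skipped = let s , s⊆xs , Ps = Any-subseqs⁻ xs skipped in s , x ∷ʳ s⊆xs , Ps

Any-subseqs⁺ : ∀ {P : List ℕ → Set} {s π} → s ⊆ π → P s → Any P (subseqs π)
Any-subseqs⁺ {π = []}     []          Ps = here Ps
Any-subseqs⁺ {π = y ∷ ys} (_ ∷ʳ s⊆ys)  Ps = Any.++⁺ʳ (map (y ∷_) (subseqs ys)) (Any-subseqs⁺ s⊆ys Ps)
Any-subseqs⁺ {π = y ∷ ys} (refl ∷ s⊆ys) Ps = Any.++⁺ˡ (Any.map⁺ (Any-subseqs⁺ s⊆ys Ps))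

Agree : ℕ → ℕ → ℕ → ℕ → Set
Agree a b p q = (a < b × p < q) ⊎ (b < a × q < p)

agree-sym : ∀ {a b p q} → Agree a b p q → Agree b a q p
agree-sym (inj₁ lt) = inj₂ lt
agree-sym (inj₂ gt) = inj₁ gt

agree⇒<⇔< : ∀ {a b p q} → Agree a b p q → (a < b) ⇔ (p < q)
agree⇒<⇔< (inj₁ (a<b , p<q)) = mk⇔ (λ _ → p<q) (λ _ → a<b)
agree⇒<⇔< (inj₂ (b<a , q<p)) = mk⇔ (λ a<b → ⊥-elim (<-asym a<b b<a)) (λ p<q → ⊥-elim (<-asym p<q q<p))

<-irrefl⇔ : ∀ a p → (a < a) ⇔ (p < p)
<-irrefl⇔ a p = mk⇔ (λ a<a → ⊥-elim (<-irrefl refl a<a)) (λ p<p → ⊥-elim (<-irrefl refl p<p))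

sameOrder₃ : ∀ {a b c p q r} → Agree a b p q → Agree a c p r → Agree b c q r →
  SameOrder (a ∷ b ∷ c ∷ []) (p ∷ q ∷ r ∷ [])
sameOrder₃ {a} {b} {c} {p} {q} {r} ab ac bc = refl , agree
  where
  agree : ∀ i j → let ps = List.zip (a ∷ b ∷ c ∷ []) (p ∷ q ∷ r ∷ []) in
    (proj₁ (List.lookup ps i) < proj₁ (List.lookup ps j)) ⇔ (proj₂ (List.lookup ps i) < proj₂ (List.lookup ps j))
  agree 0F 0F = <-irrefl⇔ a p
  agree 0F 1F = agree⇒<⇔< ab
  agree 0F 2F = agree⇒<⇔< ac
  agree 1F 0F = agree⇒<⇔< (agree-sym ab)
  agree 1F 1F = <-irrefl⇔ b q
  agree 1F 2F = agree⇒<⇔< bc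
  agree 2F 0F = agree⇒<⇔< (agree-sym ac)
  agree 2F 1F = agree⇒<⇔< (agree-sym bc)
  agree 2F 2F = <-irrefl⇔ c r

record OrderPattern (p q r : ℕ) (R : ℕ → ℕ → ℕ → Set) : Set where
  field
    sameOrder⁺ : ∀ {a b c} → R a b c → SameOrder (a ∷ b ∷ c ∷ []) (p ∷ q ∷ r ∷ [])
    sameOrder⁻ : ∀ {a b c} → SameOrder (a ∷ b ∷ c ∷ []) (p ∷ q ∷ r ∷ []) → R a b c

Avoids₃ : (ℕ → ℕ → ℕ → Set) → List ℕ → Set
Avoids₃ R π = ∀ {a b c} → a ∷ b ∷ c ∷ [] ⊆ π → ¬ R a b c

module _ {p q r R} (τ : OrderPattern p q r R) where
  open OrderPattern τ

  avoids⇒avoids₃ : ∀ {π} → Avoids π (p ∷ q ∷ r ∷ []) → Avoids₃ R π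
  avoids⇒avoids₃ avoids abc⊆π Rabc = avoids (Any-subseqs⁺ abc⊆π (sameOrder⁺ Rabc))

  avoids₃⇒avoids : ∀ {π} → Avoids₃ R π → Avoids π (p ∷ q ∷ r ∷ [])
  avoids₃⇒avoids {π} avoids occurs with Any-subseqs⁻ π occurs
  ... | a ∷ b ∷ c ∷ [] , abc⊆π , same = avoids abc⊆π (sameOrder⁻ same)

Ord312 Ord132 Ord231 : ℕ → ℕ → ℕ → Set
Ord312 a b c = b < c × c < a
Ord132 a b c = a < c × c < b
Ord231 a b c = c < a × a < b

private
  1<2 : 1 < 2
  1<2 = s<s z<s
  1<3 : 1 < 3
  1<3 = s<s z<s
  2<3 : 2 < 3
  2<3 = s<s (s<s z<s)

pattern312 : OrderPattern 3 1 2 Ord312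
pattern312 = record
  { sameOrder⁺ = λ (b<c , c<a) → sameOrder₃ (inj₂ (<-trans b<c c<a , 1<3)) (inj₂ (c<a , 2<3)) (inj₁ (b<c , 1<2))
  ; sameOrder⁻ = λ (_ , agree) → Equivalence.from (agree 1F 2F) 1<2 , Equivalence.from (agree 2F 0F) 2<3
  }

pattern132 : OrderPattern 1 3 2 Ord132
pattern132 = record
  { sameOrder⁺ = λ (a<c , c<b) → sameOrder₃ (inj₁ (<-trans a<c c<b , 1<3)) (inj₁ (a<c , 1<2)) (inj₂ (c<b , 2<3))
  ; sameOrder⁻ = λ (_ , agree) → Equivalence.from (agree 0F 2F) 1<2 , Equivalence.from (agree 2F 1F) 2<3
  }

pattern231 : OrderPattern 2 3 1 Ord231
pattern231 = record
  { sameOrder⁺ = λ (c<a , a<b) → sameOrder₃ (inj₁ (a<b , 2<3)) (inj₂ (c<a , 1<2)) (inj₂ (<-trans c<a a<b , 1<3))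
  ; sameOrder⁻ = λ (_ , agree) → Equivalence.from (agree 2F 0F) 1<2 , Equivalence.from (agree 0F 1F) 2<3
  }

_∪₃_ : (R S : ℕ → ℕ → ℕ → Set) → ℕ → ℕ → ℕ → Set
(R ∪₃ S) a b c = R a b c ⊎ S a b c

Avoids₃-∪ : ∀ {R S π} → Avoids₃ R π → Avoids₃ S π → Avoids₃ (R ∪₃ S) π
Avoids₃-∪ avoidsR avoidsS abc⊆π (inj₁ Rabc) = avoidsR abc⊆π Rabc
Avoids₃-∪ avoidsR avoidsS abc⊆π (inj₂ Sabc) = avoidsS abc⊆π Sabc

Avoids₃-⊆ : ∀ {R π π′} → π′ ⊆ π → Avoids₃ R π → Avoids₃ R π′
Avoids₃-⊆ π′⊆π avoids abc⊆π′ = avoids (⊆-trans abc⊆π′ π′⊆π)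

Avoids₃-++ : ∀ {R : ℕ → ℕ → ℕ → Set} {xs ys} → (∀ {a b c} → R a b c → c < a) →
  (∀ {x y} → x ∈ xs → y ∈ ys → x < y) → Avoids₃ R xs → Avoids₃ R ys → Avoids₃ R (xs ++ ys)
Avoids₃-++ {xs = xs} c<a xs<ys avoidsˡ avoidsʳ abc⊆ Rabc with ⊆-++-split xs abc⊆
... | []             , _ , refl , _  , τ₂ = avoidsʳ τ₂ Rabc
... | _ ∷ []         , _ , refl , τ₁ , τ₂ = <-asym (xs<ys (to∈ τ₁) (lookup τ₂ (there (here refl)))) (c<a Rabc)
... | _ ∷ _ ∷ []     , _ , refl , τ₁ , τ₂ = <-asym (xs<ys (to∈ τ₁) (to∈ τ₂)) (c<a Rabc)
... | _ ∷ _ ∷ _ ∷ [] , _ , refl , τ₁ , _  = avoidsˡ τ₁ Rabc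

record IntervalPerm (b N : ℕ) (π : List ℕ) : Set where
  field
    length≡ : length π ≡ N
    unique  : Unique π
    bounded : All (λ v → b ≤ v × v < b + N) π

  lower : ∀ {v} → v ∈ π → b ≤ v
  lower v∈π = proj₁ (All.lookup bounded v∈π)

  upper : ∀ {v} → v ∈ π → v < b + N
  upper v∈π = proj₂ (All.lookup bounded v∈π)

  complete : ∀ {v} → b ≤ v → v < b + N → v ∈ π
  complete {v} b≤v v<b+N with v ∈? π
  ... | yes v∈π = v∈π
  ... | no  v∉π = ⊥-elim (<⇒≱ (s≤s (≤-reflexive (sym length≡))) too-long)
    where
    interval : List ℕ
    interval = map (b +_) (upTo N)
    ∈-interval : ∀ {u} → b ≤ u → u < b + N → u ∈ interval
    ∈-interval {u} b≤u u<b+N = subst (_∈ interval) (m+[n∸m]≡n b≤u)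
      (∈-map⁺ (b +_) (∈-upTo⁺ (subst (u ∸ b <_) (m+n∸m≡n b N) (∸-monoˡ-< u<b+N b≤u))))
    too-long : length (v ∷ π) ≤ N
    too-long = begin
      length (v ∷ π) ≤⟨ Unique⊆⇒length≤ (All.tabulate (λ { u∈π refl → v∉π u∈π }) ∷ unique)
                          (λ { (here refl) → ∈-interval b≤v v<b+N
                             ; (there u∈π) → ∈-interval (lower u∈π) (upper u∈π) }) ⟩
      length interval ≡⟨ length-map (b +_) (upTo N) ⟩
      length (upTo N) ≡⟨ length-upTo N ⟩
      N ∎
      where open ≤-Reasoning

record Occupies (p : List ℕ) (lo hi : ℕ) : Set where
  field
    bounds   : ∀ {v} → v ∈ p → lo ≤ v × v ≤ hi
    complete : ∀ {v} → lo ≤ v → v ≤ hi → v ∈ p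

  outside : ∀ {y} → y ∉ p → y < lo ⊎ hi < y
  outside {y} y∉p with lo ≤? y | y ≤? hi
  ... | yes lo≤y | yes y≤hi = ⊥-elim (y∉p (complete lo≤y y≤hi))
  ... | no  lo≰y | _        = inj₁ (≰⇒> lo≰y)
  ... | _        | no  y≰hi = inj₂ (≰⇒> y≰hi)

occupies-singleton : ∀ x → Occupies [ x ] x x
occupies-singleton x = record
  { bounds   = λ { (here refl) → ≤-refl , ≤-refl }
  ; complete = λ x≤v v≤x → here (≤-antisym v≤x x≤v)
  }

occupies-below : ∀ {p y hi} → Occupies p (suc y) hi → suc y ≤ hi → Occupies (p ++ [ y ]) y hi
occupies-below {p} {y} {hi} occ sy≤hi = record { bounds = bounds′ ; complete = complete′ }
  where
  open Occupies occ
  bounds′ : ∀ {v} → v ∈ p ++ [ y ] → y ≤ v × v ≤ hi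
  bounds′ v∈ with ∈-++⁻ p v∈
  ... | inj₁ v∈p         = let sy≤v , v≤hi = bounds v∈p in ≤-trans (n≤1+n y) sy≤v , v≤hi
  ... | inj₂ (here refl) = ≤-refl , ≤-trans (n≤1+n y) sy≤hi
  complete′ : ∀ {v} → y ≤ v → v ≤ hi → v ∈ p ++ [ y ]
  complete′ {v} y≤v v≤hi with y ≟ v
  ... | yes refl = ∈-++⁺ʳ p (here refl)
  ... | no  y≢v  = ∈-++⁺ˡ (complete (≤∧≢⇒< y≤v y≢v) v≤hi)

occupies-above : ∀ {p lo hi} → Occupies p lo hi → lo ≤ hi → Occupies (p ++ [ suc hi ]) lo (suc hi)
occupies-above {p} {lo} {hi} occ lo≤hi = record { bounds = bounds′ ; complete = complete′ }
  where
  open Occupies occ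
  bounds′ : ∀ {v} → v ∈ p ++ [ suc hi ] → lo ≤ v × v ≤ suc hi
  bounds′ v∈ with ∈-++⁻ p v∈
  ... | inj₁ v∈p         = let lo≤v , v≤hi = bounds v∈p in lo≤v , ≤-trans v≤hi (n≤1+n hi)
  ... | inj₂ (here refl) = ≤-trans lo≤hi (n≤1+n hi) , ≤-refl
  complete′ : ∀ {v} → lo ≤ v → v ≤ suc hi → v ∈ p ++ [ suc hi ]
  complete′ {v} lo≤v v≤shi with v ≟ suc hi
  ... | yes refl = ∈-++⁺ʳ p (here refl)
  ... | no  v≢sh = ∈-++⁺ˡ (complete lo≤v (≤-pred (≤∧≢⇒< v≤shi v≢sh)))

#descents #ascents : List Bool → ℕ
#descents []          = 0
#descents (true ∷ w)  = #descents w
#descents (false ∷ w) = suc (#descents w)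
#ascents []          = 0
#ascents (true ∷ w)  = suc (#ascents w)
#ascents (false ∷ w) = #ascents w

#descents+#ascents : ∀ w → #descents w + #ascents w ≡ length w
#descents+#ascents []          = refl
#descents+#ascents (true ∷ w)  = trans (+-suc (#descents w) (#ascents w)) (cong suc (#descents+#ascents w))
#descents+#ascents (false ∷ w) = cong suc (#descents+#ascents w)

-- The values used so far form the interval [lo, hi]; an ascent appends the new
-- maximum, a descent the new minimum.  All lemmas assume #descents w ≤ lo, so lo ∸ 1
-- never truncates.
extend : ℕ → ℕ → List Bool → List ℕ
extend lo hi []          = []
extend lo hi (true ∷ w)  = suc hi ∷ extend lo (suc hi) w
extend lo hi (false ∷ w) = lo ∸ 1 ∷ extend (lo ∸ 1) hi w

extremal : List Bool → List ℕ
extremal w = #descents w ∷ extend (#descents w) (#descents w) w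

length-extend : ∀ lo hi w → length (extend lo hi w) ≡ length w
length-extend lo hi []          = refl
length-extend lo hi (true ∷ w)  = cong suc (length-extend lo (suc hi) w)
length-extend lo hi (false ∷ w) = cong suc (length-extend (lo ∸ 1) hi w)

extend-outside : ∀ lo hi w → #descents w ≤ lo → ∀ {v} → v ∈ extend lo hi w → v < lo ⊎ hi < v
extend-outside lo       hi (true ∷ w)  d≤lo (here refl) = inj₂ (n<1+n hi)
extend-outside lo       hi (true ∷ w)  d≤lo (there v∈)  with extend-outside lo (suc hi) w d≤lo v∈
... | inj₁ v<lo  = inj₁ v<lo
... | inj₂ sh<v  = inj₂ (<-trans (n<1+n hi) sh<v)
extend-outside (suc lo) hi (false ∷ w) d≤lo (here refl) = inj₁ (n<1+n lo)
extend-outside (suc lo) hi (false ∷ w) d≤lo (there v∈)  with extend-outside lo hi w (≤-pred d≤lo) v∈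
... | inj₁ v<lo  = inj₁ (<-trans v<lo (n<1+n lo))
... | inj₂ hi<v  = inj₂ hi<v

extend-≤ : ∀ lo hi w → #descents w ≤ lo → lo ≤ hi → ∀ {v} → v ∈ extend lo hi w → v ≤ hi + #ascents w
extend-≤ lo       hi (true ∷ w)  d≤lo lo≤hi (here refl) =
  ≤-trans (m≤m+n (suc hi) (#ascents w)) (≤-reflexive (sym (+-suc hi (#ascents w))))
extend-≤ lo       hi (true ∷ w)  d≤lo lo≤hi (there v∈)  =
  ≤-trans (extend-≤ lo (suc hi) w d≤lo (≤-trans lo≤hi (n≤1+n hi)) v∈) (≤-reflexive (sym (+-suc hi (#ascents w))))
extend-≤ (suc lo) hi (false ∷ w) d≤lo lo≤hi (here refl) = ≤-trans (≤-trans (n≤1+n lo) lo≤hi) (m≤m+n hi (#ascents w))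
extend-≤ (suc lo) hi (false ∷ w) d≤lo lo≤hi (there v∈)  =
  extend-≤ lo hi w (≤-pred d≤lo) (≤-trans (n≤1+n lo) lo≤hi) v∈

extend-Unique : ∀ lo hi w → #descents w ≤ lo → lo ≤ hi → Unique (extend lo hi w)
extend-Unique lo       hi []          d≤lo lo≤hi = []
extend-Unique lo       hi (true ∷ w)  d≤lo lo≤hi =
  All.tabulate new ∷ extend-Unique lo (suc hi) w d≤lo (≤-trans lo≤hi (n≤1+n hi))
  where
  new : ∀ {v} → v ∈ extend lo (suc hi) w → suc hi ≢ v
  new v∈ refl with extend-outside lo (suc hi) w d≤lo v∈
  ... | inj₁ sh<lo = <⇒≱ sh<lo (≤-trans lo≤hi (n≤1+n hi))
  ... | inj₂ sh<sh = <-irrefl refl sh<sh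
extend-Unique (suc lo) hi (false ∷ w) d≤lo lo≤hi =
  All.tabulate new ∷ extend-Unique lo hi w (≤-pred d≤lo) (≤-trans (n≤1+n lo) lo≤hi)
  where
  new : ∀ {v} → v ∈ extend lo hi w → lo ≢ v
  new v∈ refl with extend-outside lo hi w (≤-pred d≤lo) v∈
  ... | inj₁ lo<lo = <-irrefl refl lo<lo
  ... | inj₂ hi<lo = <⇒≱ hi<lo (≤-trans (n≤1+n lo) lo≤hi)

ascentWord-extend : ∀ lo hi w u → lo ≤ u → u ≤ hi → #descents w ≤ lo → ascentWord (u ∷ extend lo hi w) ≡ w
ascentWord-extend lo       hi []          u lo≤u u≤hi d≤lo = refl
ascentWord-extend lo       hi (true ∷ w)  u lo≤u u≤hi d≤lo rewrite <⇒<ᵇ≡true (s≤s u≤hi) =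
  cong (true ∷_) (ascentWord-extend lo (suc hi) w (suc hi) (≤-trans (≤-trans lo≤u u≤hi) (n≤1+n hi)) ≤-refl d≤lo)
ascentWord-extend (suc lo) hi (false ∷ w) u lo≤u u≤hi d≤lo rewrite ≤⇒<ᵇ≡false (≤-trans (n≤1+n lo) lo≤u) =
  cong (false ∷_) (ascentWord-extend lo hi w lo ≤-refl (≤-trans (n≤1+n lo) (≤-trans lo≤u u≤hi)) (≤-pred d≤lo))

NewExtreme : ℕ → ℕ → ℕ → ℕ → Set
NewExtreme lo hi u v = (v < lo × v < u) ⊎ (hi < v × u < v)

extend-NewExtreme : ∀ lo hi w → #descents w ≤ lo → lo ≤ hi →
  ∀ {u v} → u ∷ v ∷ [] ⊆ extend lo hi w → NewExtreme lo hi u v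
extend-NewExtreme lo hi (true ∷ w) d≤lo lo≤hi (refl ∷ v⊆)
  with extend-outside lo (suc hi) w d≤lo (to∈ v⊆)
... | inj₁ v<lo  = inj₁ (v<lo , <-trans v<lo (s≤s lo≤hi))
... | inj₂ sh<v  = inj₂ (<-trans (n<1+n hi) sh<v , sh<v)
extend-NewExtreme lo hi (true ∷ w) d≤lo lo≤hi (_ ∷ʳ uv⊆)
  with extend-NewExtreme lo (suc hi) w d≤lo (≤-trans lo≤hi (n≤1+n hi)) uv⊆
... | inj₁ below        = inj₁ below
... | inj₂ (sh<v , u<v) = inj₂ (<-trans (n<1+n hi) sh<v , u<v)
extend-NewExtreme (suc lo) hi (false ∷ w) d≤lo lo≤hi (refl ∷ v⊆)
  with extend-outside lo hi w (≤-pred d≤lo) (to∈ v⊆)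
... | inj₁ v<lo  = inj₁ (<-trans v<lo (n<1+n lo) , v<lo)
... | inj₂ hi<v  = inj₂ (hi<v , ≤-<-trans (≤-trans (n≤1+n lo) lo≤hi) hi<v)
extend-NewExtreme (suc lo) hi (false ∷ w) d≤lo lo≤hi (_ ∷ʳ uv⊆)
  with extend-NewExtreme lo hi w (≤-pred d≤lo) (≤-trans (n≤1+n lo) lo≤hi) uv⊆
... | inj₁ (v<lo , v<u) = inj₁ (<-trans v<lo (n<1+n lo) , v<u)
... | inj₂ above        = inj₂ above

NewExtreme⇒¬between : ∀ {lo hi a b c} → lo ≤ hi → NewExtreme lo hi a c → NewExtreme lo hi b c →
  ¬ (Ord312 ∪₃ Ord132) a b c
NewExtreme⇒¬between _     _                  (inj₁ (_ , c<b))   (inj₁ (b<c , _)) = <-asym b<c c<b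
NewExtreme⇒¬between _     (inj₂ (_ , a<c))   _                  (inj₁ (_ , c<a)) = <-asym a<c c<a
NewExtreme⇒¬between lo≤hi (inj₁ (c<lo , _))  (inj₂ (hi<c , _))  (inj₁ _)         = <-irrefl refl (<-trans c<lo (≤-<-trans lo≤hi hi<c))
NewExtreme⇒¬between _     (inj₁ (_ , c<a))   _                  (inj₂ (a<c , _)) = <-asym a<c c<a
NewExtreme⇒¬between _     _                  (inj₂ (_ , b<c))   (inj₂ (_ , c<b)) = <-asym b<c c<b
NewExtreme⇒¬between lo≤hi (inj₂ (hi<c , _))  (inj₁ (c<lo , _))  (inj₂ _)         = <-irrefl refl (<-trans c<lo (≤-<-trans lo≤hi hi<c))

module _ (w : List Bool) where

  private
    x : ℕ
    x = #descents w

  extremal-IntervalPerm : IntervalPerm 0 (suc (length w)) (extremal w)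
  extremal-IntervalPerm = record
    { length≡ = cong suc (length-extend x x w)
    ; unique  = All.tabulate head-new ∷ extend-Unique x x w ≤-refl ≤-refl
    ; bounded = (z≤n , s≤s (x≤length (m≤m+n x (#ascents w))))
                ∷ All.tabulate (λ v∈ → z≤n , s≤s (x≤length (extend-≤ x x w ≤-refl ≤-refl v∈)))
    }
    where
    x≤length : ∀ {v} → v ≤ x + #ascents w → v ≤ length w
    x≤length v≤ = ≤-trans v≤ (≤-reflexive (#descents+#ascents w))
    head-new : ∀ {v} → v ∈ extend x x w → x ≢ v
    head-new v∈ refl with extend-outside x x w ≤-refl v∈
    ... | inj₁ x<x = <-irrefl refl x<x
    ... | inj₂ x<x = <-irrefl refl x<x

  ascentWord-extremal : ascentWord (extremal w) ≡ w
  ascentWord-extremal = ascentWord-extend x x w x ≤-refl ≤-refl ≤-refl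

  extremal-NewExtreme : ∀ {u v} → u ∷ v ∷ [] ⊆ extremal w → NewExtreme x x u v
  extremal-NewExtreme (refl ∷ v⊆) with extend-outside x x w ≤-refl (to∈ v⊆)
  ... | inj₁ v<x = inj₁ (v<x , v<x)
  ... | inj₂ x<v = inj₂ (x<v , x<v)
  extremal-NewExtreme (_ ∷ʳ uv⊆) = extend-NewExtreme x x w ≤-refl ≤-refl uv⊆

  extremal-avoids : Avoids₃ (Ord312 ∪₃ Ord132) (extremal w)
  extremal-avoids {a} {b} {c} abc⊆ = NewExtreme⇒¬between ≤-refl
    (extremal-NewExtreme (⊆-trans (refl ∷ b ∷ʳ ⊆-refl) abc⊆))
    (extremal-NewExtreme (⊆-trans (a ∷ʳ ⊆-refl) abc⊆))

module ExtremalReconstruction {n π} (ip : IntervalPerm 0 n π) (avoids : Avoids₃ (Ord312 ∪₃ Ord132) π) where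
  open IntervalPerm ip

  private
    prefix∈ : ∀ p {s v} → p ++ s ≡ π → v ∈ p → v ∈ π
    prefix∈ p eq v∈p = subst (_ ∈_) eq (∈-++⁺ˡ v∈p)

    suffix∈ : ∀ p {y s v} → p ++ y ∷ s ≡ π → v ∈ π → v ∉ p → v ≢ y → v ∈ s
    suffix∈ p eq v∈π = ∈-++-∷⁻ p (subst (_ ∈_) (sym eq) v∈π)

    ∉prefix : ∀ p {y s} → p ++ y ∷ s ≡ π → y ∉ p
    ∉prefix p eq = proj₂ (Unique-++⁻ p (subst Unique (sym eq) unique)) (here refl)

  -- otherwise (suc v, y, v) would be an occurrence of 312
  next-below : ∀ p {y s v} → p ++ y ∷ s ≡ π → suc v ∈ p → v ∉ p → y < suc v → y ≡ v
  next-below p {y} {s} {v} eq sv∈p v∉p y<sv with <-cmp y v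
  ... | tri≈ _ y≡v _ = y≡v
  ... | tri> _ _ v<y = ⊥-elim (<⇒≱ y<sv v<y)
  ... | tri< y<v _ _ = ⊥-elim (avoids (subst (_ ⊆_) eq (∈-∈-⊆ sv∈p v∈s)) (inj₁ (y<v , n<1+n v)))
    where
    v∈s : v ∈ s
    v∈s = suffix∈ p eq (complete z≤n (<-trans (n<1+n v) (upper (prefix∈ p eq sv∈p)))) v∉p
            (λ v≡y → <-irrefl (sym v≡y) y<v)

  -- otherwise (h, y, suc h) would be an occurrence of 132
  next-above : ∀ p {y s h} → p ++ y ∷ s ≡ π → h ∈ p → suc h ∉ p → h < y → y ≡ suc h
  next-above p {y} {s} {h} eq h∈p sh∉p h<y with <-cmp y (suc h)
  ... | tri≈ _ y≡sh _ = y≡sh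
  ... | tri< y<sh _ _ = ⊥-elim (<⇒≱ h<y (≤-pred y<sh))
  ... | tri> _ _ sh<y = ⊥-elim (avoids (subst (_ ⊆_) eq (∈-∈-⊆ h∈p sh∈s)) (inj₂ (n<1+n h , sh<y)))
    where
    sh∈s : suc h ∈ s
    sh∈s = suffix∈ p eq (complete z≤n (<-trans sh<y (upper (subst (_ ∈_) eq (∈-++⁺ʳ p (here refl)))))) sh∉p
             (λ sh≡y → <-irrefl sh≡y sh<y)

  -- c stands for the last entry of p; only lo ≤ c ≤ hi is used.
  reconstruct : ∀ p s {lo hi c} → p ++ s ≡ π → Occupies p lo hi → lo ≤ c → c ≤ hi →
    lo ≡ #descents (ascentWord (c ∷ s)) × s ≡ extend lo hi (ascentWord (c ∷ s))
  reconstruct p [] eq occ lo≤c c≤hi = n≤0⇒n≡0 (proj₁ (Occupies.bounds occ 0∈p)) , refl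
    where
    0∈p : 0 ∈ p
    0∈p = subst (0 ∈_) (trans (sym eq) (++-identityʳ p))
            (complete z≤n (≤-<-trans z≤n (upper (prefix∈ p eq (Occupies.complete occ lo≤c c≤hi)))))
  reconstruct p (y ∷ s) eq occ lo≤c c≤hi with Occupies.outside occ (∉prefix p eq)
  reconstruct p (y ∷ s) {zero}  eq occ lo≤c c≤hi | inj₁ ()
  reconstruct p (y ∷ s) {suc v} {hi} {c} eq occ lo≤c c≤hi | inj₁ y<sv
    with next-below p eq (Occupies.complete occ ≤-refl (≤-trans lo≤c c≤hi))
                         (λ v∈p → 1+n≰n (proj₁ (Occupies.bounds occ v∈p))) y<sv
  ... | refl rewrite ≤⇒<ᵇ≡false {c} {y} (≤-trans (n≤1+n y) lo≤c) =
    let y≡d , s≡ = reconstruct (p ++ [ y ]) s (trans (++-assoc p [ y ] s) eq)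
                     (occupies-below occ (≤-trans lo≤c c≤hi)) ≤-refl (≤-trans (n≤1+n y) (≤-trans lo≤c c≤hi))
    in cong suc y≡d , cong (y ∷_) s≡
  reconstruct p (y ∷ s) {lo} {hi} {c} eq occ lo≤c c≤hi | inj₂ hi<y
    with next-above p eq (Occupies.complete occ (≤-trans lo≤c c≤hi) ≤-refl)
                         (λ sh∈p → 1+n≰n (proj₂ (Occupies.bounds occ sh∈p))) hi<y
  ... | refl rewrite <⇒<ᵇ≡true {c} {suc hi} (s≤s c≤hi) =
    let lo≡d , s≡ = reconstruct (p ++ [ suc hi ]) s (trans (++-assoc p [ suc hi ] s) eq)
                      (occupies-above occ (≤-trans lo≤c c≤hi)) (≤-trans (≤-trans lo≤c c≤hi) (n≤1+n hi)) ≤-refl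
    in lo≡d , cong (suc hi ∷_) s≡

extremal-ascentWord : ∀ {n} π → IntervalPerm 0 (suc n) π → Avoids₃ (Ord312 ∪₃ Ord132) π → extremal (ascentWord π) ≡ π
extremal-ascentWord (x ∷ s) ip avoids
  with ExtremalReconstruction.reconstruct ip avoids [ x ] s refl (occupies-singleton x) ≤-refl ≤-refl
... | x≡d , s≡ = sym (cong₂ _∷_ x≡d (trans s≡ (cong (λ z → extend z z (ascentWord (x ∷ s))) x≡d)))

run : ℕ → ℕ → List ℕ
run c zero    = [ c ]
run c (suc k) = c + suc k ∷ run c k

length-run : ∀ c k → length (run c k) ≡ suc k
length-run c zero    = refl
length-run c (suc k) = cong suc (length-run c k)

run-head : ∀ c k → ∃ λ t → run c k ≡ c + k ∷ t
run-head c zero    = [] , cong [_] (sym (+-identityʳ c))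
run-head c (suc k) = run c k , refl

run-bounds : ∀ c k {v} → v ∈ run c k → c ≤ v × v ≤ c + k
run-bounds c zero    (here refl) = ≤-refl , m≤m+n c 0
run-bounds c (suc k) (here refl) = m≤m+n c (suc k) , ≤-refl
run-bounds c (suc k) (there v∈)  = let c≤v , v≤c+k = run-bounds c k v∈ in c≤v , ≤-trans v≤c+k (+-monoʳ-≤ c (n≤1+n k))

∈-run : ∀ c k {v} → c ≤ v → v ≤ c + k → v ∈ run c k
∈-run c zero    {v} c≤v v≤c+0 = here (≤-antisym (≤-trans v≤c+0 (≤-reflexive (+-identityʳ c))) c≤v)
∈-run c (suc k) {v} c≤v v≤c+sk with v ≟ c + suc k
... | yes v≡top = here v≡top
... | no  v≢top = there (∈-run c k c≤v (≤-pred (subst (v <_) (+-suc c k) (≤∧≢⇒< v≤c+sk v≢top))))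

run-snoc : ∀ c k → run (suc c) k ++ [ c ] ≡ run c (suc k)
run-snoc c zero    = cong (λ z → z ∷ [ c ]) (trans (cong suc (sym (+-identityʳ c))) (sym (+-suc c 0)))
run-snoc c (suc k) = cong₂ _∷_ (sym (+-suc c (suc k))) (run-snoc c k)

run-decreasing : ∀ c k {u v} → u ∷ v ∷ [] ⊆ run c k → v < u
run-decreasing c zero    (_ ∷ʳ ())
run-decreasing c zero    (refl ∷ ())
run-decreasing c (suc k) (refl ∷ v⊆) = ≤-<-trans (proj₂ (run-bounds c k (to∈ v⊆))) (+-monoʳ-< c (n<1+n k))
run-decreasing c (suc k) (_ ∷ʳ uv⊆) = run-decreasing c k uv⊆

run-Unique : ∀ c k → Unique (run c k)
run-Unique c zero    = [] ∷ []
run-Unique c (suc k) =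
  All.tabulate (λ v∈ top≡v → <-irrefl (sym top≡v) (run-decreasing c (suc k) (refl ∷ from∈ v∈))) ∷ run-Unique c k

run-avoids : ∀ c k → Avoids₃ (Ord312 ∪₃ Ord231) (run c k)
run-avoids c k {a} {_} {z} abc⊆ (inj₁ (b<z , _)) = <-asym b<z (run-decreasing c k (⊆-trans (a ∷ʳ ⊆-refl) abc⊆))
run-avoids c k {_} {_} {z} abc⊆ (inj₂ (_ , a<b)) = <-asym a<b (run-decreasing c k (⊆-trans (refl ∷ refl ∷ z ∷ʳ []) abc⊆))

ascentWord-run++ : ∀ c k ys → ascentWord (run c k ++ ys) ≡ replicate k false ++ ascentWord (c ∷ ys)
ascentWord-run++ c zero    ys = refl
ascentWord-run++ c (suc k) ys with run c k | run-head c k | ascentWord-run++ c k ys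
... | _ | t , refl | ih rewrite ≤⇒<ᵇ≡false {c + suc k} {c + k} (+-monoʳ-≤ c (n≤1+n k)) = cong (false ∷_) ih

-- The current run is b + k, …, b; a descent lengthens it, an ascent closes it and
-- starts the next run just above it.
layers : ℕ → ℕ → List Bool → List ℕ
layers b k []          = run b k
layers b k (false ∷ w) = layers b (suc k) w
layers b k (true ∷ w)  = run b k ++ layers (b + suc k) 0 w

layered : List Bool → List ℕ
layered = layers 0 0

length-layers : ∀ b k w → length (layers b k w) ≡ suc k + length w
length-layers b k []          = trans (length-run b k) (cong suc (sym (+-identityʳ k)))
length-layers b k (false ∷ w) = trans (length-layers b (suc k) w) (cong suc (sym (+-suc k (length w))))
length-layers b k (true ∷ w)  = trans (length-++ (run b k)) (cong₂ _+_ (length-run b k) (length-layers (b + suc k) 0 w))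

layers-bounds : ∀ b k w {v} → v ∈ layers b k w → b ≤ v × v ≤ b + k + length w
layers-bounds b k [] {v} v∈ =
  let b≤v , v≤b+k = run-bounds b k v∈ in b≤v , subst (v ≤_) (sym (+-identityʳ (b + k))) v≤b+k
layers-bounds b k (false ∷ w) {v} v∈ =
  let b≤v , v≤ = layers-bounds b (suc k) w v∈ in b≤v , ≤-trans v≤ (≤-reflexive (shift b k (length w)))
  where
  shift : ∀ b k l → b + suc k + l ≡ b + k + suc l
  shift = solve-∀
layers-bounds b k (true ∷ w) {v} v∈ with ∈-++⁻ (run b k) v∈
... | inj₁ v∈run = let b≤v , v≤b+k = run-bounds b k v∈run in b≤v , ≤-trans v≤b+k (m≤m+n (b + k) _)
... | inj₂ v∈rest =
  let b+sk≤v , v≤ = layers-bounds (b + suc k) 0 w v∈rest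
  in ≤-trans (m≤m+n b (suc k)) b+sk≤v , ≤-trans v≤ (≤-reflexive (shift b k (length w)))
  where
  shift : ∀ b k l → b + suc k + 0 + l ≡ b + k + suc l
  shift = solve-∀

run<layers : ∀ b k w {x y} → x ∈ run b k → y ∈ layers (b + suc k) 0 w → x < y
run<layers b k w {y = y} x∈ y∈ =
  ≤-<-trans (proj₂ (run-bounds b k x∈)) (subst (_≤ y) (+-suc b k) (proj₁ (layers-bounds (b + suc k) 0 w y∈)))

layers-Unique : ∀ b k w → Unique (layers b k w)
layers-Unique b k []          = run-Unique b k
layers-Unique b k (false ∷ w) = layers-Unique b (suc k) w
layers-Unique b k (true ∷ w)  = Unique.++⁺ (run-Unique b k) (layers-Unique (b + suc k) 0 w)
  (λ (x∈ , x∈′) → <-irrefl refl (run<layers b k w x∈ x∈′))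

layers-avoids : ∀ b k w → Avoids₃ (Ord312 ∪₃ Ord231) (layers b k w)
layers-avoids b k []          = run-avoids b k
layers-avoids b k (false ∷ w) = layers-avoids b (suc k) w
layers-avoids b k (true ∷ w)  = Avoids₃-++ c<a (run<layers b k w) (run-avoids b k) (layers-avoids (b + suc k) 0 w)
  where
  c<a : ∀ {a b c} → (Ord312 ∪₃ Ord231) a b c → c < a
  c<a (inj₁ (_ , c<a)) = c<a
  c<a (inj₂ (c<a , _)) = c<a

ascentWord-layers : ∀ b k w → ascentWord (layers b k w) ≡ replicate k false ++ w
ascentWord-layers b k []          = trans (cong ascentWord (sym (++-identityʳ (run b k)))) (ascentWord-run++ b k [])
ascentWord-layers b k (false ∷ w) = trans (ascentWord-layers b (suc k) w) (replicate-suc-++ k)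
  where
  replicate-suc-++ : ∀ k → replicate (suc k) false ++ w ≡ replicate k false ++ false ∷ w
  replicate-suc-++ zero    = refl
  replicate-suc-++ (suc k) = cong (false ∷_) (replicate-suc-++ k)
ascentWord-layers b k (true ∷ w)
  with layers (b + suc k) 0 w | length-layers (b + suc k) 0 w | layers-bounds (b + suc k) 0 w | ascentWord-layers (b + suc k) 0 w
... | []    | () | _      | _
... | y ∷ t | _  | bounds | ih = begin
  ascentWord (run b k ++ y ∷ t)                        ≡⟨ ascentWord-run++ b k (y ∷ t) ⟩
  replicate k false ++ (b <ᵇ y) ∷ ascentWord (y ∷ t)  ≡⟨ cong (λ z → replicate k false ++ z) (cong₂ _∷_ b<ᵇy ih) ⟩
  replicate k false ++ true ∷ w                        ∎
  where
  open ≡-Reasoning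
  b<ᵇy : (b <ᵇ y) ≡ true
  b<ᵇy = <⇒<ᵇ≡true (<-≤-trans (s≤s (m≤m+n b k)) (subst (_≤ y) (+-suc b k) (proj₁ (bounds (here refl)))))

above-run : ∀ {b N k s} → IntervalPerm b N (run b k ++ s) → IntervalPerm (b + suc k) (length s) s
above-run {b} {N} {k} {s} ip = record
  { length≡ = refl
  ; unique  = proj₁ (Unique-++⁻ (run b k) unique)
  ; bounded = All.tabulate λ {v} v∈s →
      subst (_≤ v) (sym (+-suc b k)) (b+k<v v∈s) ,
      subst (v <_) (trans (cong (b +_) N≡) (sym (+-assoc b (suc k) (length s)))) (upper (∈-++⁺ʳ (run b k) v∈s))
  }
  where
  open IntervalPerm ip
  N≡ : N ≡ suc k + length s
  N≡ = trans (sym length≡) (trans (length-++ (run b k)) (cong (_+ length s) (length-run b k)))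
  b+k<v : ∀ {v} → v ∈ s → b + k < v
  b+k<v {v} v∈s with v ≤? b + k
  ... | yes v≤b+k = ⊥-elim (proj₂ (Unique-++⁻ (run b k) unique) v∈s (∈-run b k (lower (∈-++⁺ʳ (run b k) v∈s)) v≤b+k))
  ... | no  v≰b+k = ≰⇒> v≰b+k

run-starts-at-base : ∀ {b N c k} → IntervalPerm b N (run c k ++ []) → c ≡ b
run-starts-at-base {b} {c = c} {k} ip = ≤-antisym (proj₁ (run-bounds c k b∈run)) (lower c∈)
  where
  open IntervalPerm ip
  c∈ : c ∈ run c k ++ []
  c∈ = ∈-++⁺ˡ (∈-run c k ≤-refl (m≤m+n c k))
  b∈run : b ∈ run c k
  b∈run = subst (b ∈_) (++-identityʳ (run c k)) (complete ≤-refl (≤-<-trans (lower c∈) (upper c∈)))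

module _ {b N c k y s} (ip : IntervalPerm b N (run (suc c) k ++ y ∷ s))
         (avoids : Avoids₃ (Ord312 ∪₃ Ord231) (run (suc c) k ++ y ∷ s)) (b≤c : b ≤ c) where
  open IntervalPerm ip

  private
    c∈s : c ≢ y → c ∈ s
    c∈s = ∈-++-∷⁻ (run (suc c) k)
      (complete b≤c (<-trans (n<1+n c) (upper (∈-++⁺ˡ (∈-run (suc c) k ≤-refl (m≤m+n (suc c) k))))))
      (λ c∈run → 1+n≰n (proj₁ (run-bounds (suc c) k c∈run)))

  -- otherwise (suc c, y, c) would be an occurrence of 312
  ¬next<run-1 : ¬ y < c
  ¬next<run-1 y<c = avoids (∈-∈-⊆ (∈-run (suc c) k ≤-refl (m≤m+n (suc c) k)) (c∈s λ c≡y → <-irrefl (sym c≡y) y<c))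
                           (inj₁ (y<c , n<1+n c))

  -- otherwise (suc c + k, y, c) would be an occurrence of 231
  ¬run-1<next : ¬ c < y
  ¬run-1<next c<y = avoids (∈-∈-⊆ (∈-run (suc c) k (m≤m+n (suc c) k) ≤-refl) (c∈s λ c≡y → <-irrefl c≡y c<y))
                           (inj₂ (≤-trans (n<1+n c) (m≤m+n (suc c) k) , top<y))
    where
    top<y : suc c + k < y
    top<y with y ≤? suc c + k
    ... | yes y≤top = ⊥-elim (proj₂ (Unique-++⁻ (run (suc c) k) unique) (here refl) (∈-run (suc c) k c<y y≤top))
    ... | no  y≰top = ≰⇒> y≰top

run++≡layers : ∀ s {b N k c} → IntervalPerm b N (run c k ++ s) → Avoids₃ (Ord312 ∪₃ Ord231) (run c k ++ s) →
  run c k ++ s ≡ layers b k (ascentWord (c ∷ s))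
run++≡layers [] {k = k} {c} ip _ = trans (++-identityʳ (run c k)) (cong (λ z → run z k) (run-starts-at-base ip))
run++≡layers (y ∷ s) {b} {N} {k} {c} ip avoids
  with m≤n⇒m<n∨m≡n (IntervalPerm.lower ip (∈-++⁺ˡ (∈-run c k ≤-refl (m≤m+n c k))))
... | inj₂ refl = begin
  run b k ++ y ∷ s                            ≡⟨ cong (run b k ++_) (run++≡layers s (above-run ip) avoids′) ⟩
  layers b k (true ∷ ascentWord (y ∷ s))      ≡⟨ cong (λ z → layers b k (z ∷ ascentWord (y ∷ s))) b<ᵇy ⟨
  layers b k ((b <ᵇ y) ∷ ascentWord (y ∷ s))  ∎
  where
  open ≡-Reasoning
  avoids′ : Avoids₃ (Ord312 ∪₃ Ord231) (y ∷ s)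
  avoids′ = Avoids₃-⊆ (Sublist.++⁺ˡ (run b k) ⊆-refl) avoids
  b<ᵇy : (b <ᵇ y) ≡ true
  b<ᵇy = <⇒<ᵇ≡true (<-≤-trans (m<m+n b {suc k} z<s) (IntervalPerm.lower (above-run ip) (here refl)))
run++≡layers (y ∷ s) {c = zero} ip avoids | inj₁ ()
run++≡layers (y ∷ s) {b} {N} {k} {suc c} ip avoids | inj₁ (s≤s b≤c) with <-cmp y c
... | tri< y<c _ _ = ⊥-elim (¬next<run-1 ip avoids b≤c y<c)
... | tri> _ _ c<y = ⊥-elim (¬run-1<next ip avoids b≤c c<y)
run++≡layers (y ∷ s) {b} {N} {k} {suc .y} ip avoids | inj₁ (s≤s b≤y) | tri≈ _ refl _ = begin
  run (suc y) k ++ y ∷ s                          ≡⟨ merge ⟩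
  run y (suc k) ++ s                              ≡⟨ run++≡layers s (subst (IntervalPerm b N) merge ip) (subst (Avoids₃ _) merge avoids) ⟩
  layers b k (false ∷ ascentWord (y ∷ s))         ≡⟨ cong (λ z → layers b k (z ∷ ascentWord (y ∷ s))) sy≮ᵇy ⟨
  layers b k ((suc y <ᵇ y) ∷ ascentWord (y ∷ s))  ∎
  where
  open ≡-Reasoning
  sy≮ᵇy : (suc y <ᵇ y) ≡ false
  sy≮ᵇy = ≤⇒<ᵇ≡false (n≤1+n y)
  merge : run (suc y) k ++ y ∷ s ≡ run y (suc k) ++ s
  merge = trans (sym (++-assoc (run (suc y) k) [ y ] s)) (cong (_++ s) (run-snoc y k))

layered-IntervalPerm : ∀ w → IntervalPerm 0 (suc (length w)) (layered w)
layered-IntervalPerm w = record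
  { length≡ = length-layers 0 0 w
  ; unique  = layers-Unique 0 0 w
  ; bounded = All.tabulate (λ v∈ → z≤n , s≤s (proj₂ (layers-bounds 0 0 w v∈)))
  }

layered-ascentWord : ∀ {n} π → IntervalPerm 0 (suc n) π → Avoids₃ (Ord312 ∪₃ Ord231) π → layered (ascentWord π) ≡ π
layered-ascentWord (x ∷ s) ip avoids = sym (run++≡layers s ip avoids)

record DescentCoding (R : ℕ → ℕ → ℕ → Set) : Set where
  field
    build              : List Bool → List ℕ
    build-IntervalPerm : ∀ w → IntervalPerm 0 (suc (length w)) (build w)
    ascentWord-build   : ∀ w → ascentWord (build w) ≡ w
    build-avoids       : ∀ w → Avoids₃ (Ord312 ∪₃ R) (build w)
    build-ascentWord   : ∀ {n} π → IntervalPerm 0 (suc n) π → Avoids₃ (Ord312 ∪₃ R) π → build (ascentWord π) ≡ π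

extremalCoding : DescentCoding Ord132
extremalCoding = record
  { build              = extremal
  ; build-IntervalPerm = extremal-IntervalPerm
  ; ascentWord-build   = ascentWord-extremal
  ; build-avoids       = extremal-avoids
  ; build-ascentWord   = extremal-ascentWord
  }

layeredCoding : DescentCoding Ord231
layeredCoding = record
  { build              = layered
  ; build-IntervalPerm = layered-IntervalPerm
  ; ascentWord-build   = ascentWord-layers 0 0
  ; build-avoids       = layers-avoids 0 0
  ; build-ascentWord   = layered-ascentWord
  }

oneLine-IntervalPerm : ∀ {n} (v : Vec (Fin n) n) → IsPerm v → IntervalPerm 0 n (oneLine v)
oneLine-IntervalPerm v perm = record
  { length≡ = trans (length-map toℕ (toList v)) (Vec.length-toList v)
  ; unique  = Unique.map⁺ toℕ-injective perm
  ; bounded = All.map⁺ (All.universal (λ i → z≤n , toℕ<n i) (toList v))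
  }

module _ {p q r R} (σ : OrderPattern p q r R) (coding : DescentCoding R) (n : ℕ) where
  open DescentCoding coding

  private
    N : ℕ
    N = suc n
    Π : List (List ℕ)
    Π = (3 ∷ 1 ∷ 2 ∷ []) ∷ (p ∷ q ∷ r ∷ []) ∷ []

  toPerm : List Bool → Vec (Fin N) N
  toPerm w = vecOf N (build w)

  oneLine-toPerm : ∀ {w} → w ∈ oddWords n → oneLine (toPerm w) ≡ build w
  oneLine-toPerm {w} w∈ with All.lookup (oddWords-sound n) w∈
  ... | refl , _ = oneLine-vecOf N (build w) length≡ (All.map proj₂ bounded)
    where open IntervalPerm (build-IntervalPerm w)

  ascentWord-toPerm : ∀ {w} → w ∈ oddWords n → ascentWord (oneLine (toPerm w)) ≡ w
  ascentWord-toPerm {w} w∈ = trans (cong ascentWord (oneLine-toPerm w∈)) (ascentWord-build w)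

  toPerm-good : ∀ {w} → w ∈ oddWords n → Good N Π (toPerm w)
  toPerm-good {w} w∈ =
    Unique.map⁻ (subst Unique (sym oneLine≡) unique) ,
    subst IsDesarrangement (sym oneLine≡) (Equivalence.from (desarrangement⇔odd nonempty) odd) ,
    subst (λ π → All (Avoids π) Π) (sym oneLine≡)
      (avoids₃⇒avoids pattern312 (λ τ o → build-avoids w τ (inj₁ o))
        ∷ avoids₃⇒avoids σ (λ τ o → build-avoids w τ (inj₂ o)) ∷ [])
    where
    open IntervalPerm (build-IntervalPerm w)
    oneLine≡ : oneLine (toPerm w) ≡ build w
    oneLine≡ = oneLine-toPerm w∈
    nonempty : 0 < length (build w)
    nonempty = subst (0 <_) (sym length≡) z<s
    odd : OddLeadingDescents (ascentWord (build w))
    odd = subst OddLeadingDescents (sym (ascentWord-build w)) (proj₂ (All.lookup (oddWords-sound n) w∈))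

  module _ {v : Vec (Fin N) N} (good : Good N Π v) where
    private
      ip : IntervalPerm 0 N (oneLine v)
      ip = oneLine-IntervalPerm v (proj₁ good)
      odd : OddLeadingDescents (ascentWord (oneLine v))
      odd = Equivalence.to (desarrangement⇔odd (subst (0 <_) (sym (IntervalPerm.length≡ ip)) z<s)) (proj₁ (proj₂ good))
      avoids : Avoids₃ (Ord312 ∪₃ R) (oneLine v)
      avoids = Avoids₃-∪ (avoids⇒avoids₃ pattern312 (All.lookup (proj₂ (proj₂ good)) (here refl)))
                         (avoids⇒avoids₃ σ (All.lookup (proj₂ (proj₂ good)) (there (here refl))))

    ascentWord∈oddWords : ascentWord (oneLine v) ∈ oddWords n
    ascentWord∈oddWords = subst (λ m → ascentWord (oneLine v) ∈ oddWords m)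
      (trans (length-ascentWord (oneLine v)) (cong (_∸ 1) (IntervalPerm.length≡ ip))) (∈-oddWords _ odd)

    toPerm-ascentWord : toPerm (ascentWord (oneLine v)) ≡ v
    toPerm-ascentWord = trans (cong (vecOf N) (build-ascentWord (oneLine v) ip avoids)) (vecOf-oneLine v)

  d≡jacobsthal : d N Π ≡ jacobsthal n
  d≡jacobsthal = begin
    length (filter (good? N Π) (words N N))  ≡⟨ length-filter≡-by-bijection (good? N Π) (words-Unique N N) (∈-words N)
                                                  (oddWords-Unique n) toPerm (λ v → ascentWord (oneLine v))
                                                  toPerm-good ascentWord-toPerm ascentWord∈oddWords toPerm-ascentWord ⟩
    length (oddWords n)                      ≡⟨ length-oddWords n ⟩
    jacobsthal n                             ∎
    where open ≡-Reasoning

theorem3p18 : (n : ℕ) (σ : List ℕ) →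
    (σ ≡ 1 ∷ 3 ∷ 2 ∷ []) ⊎ (σ ≡ 2 ∷ 3 ∷ 1 ∷ []) →
    d (suc n) ((3 ∷ 1 ∷ 2 ∷ []) ∷ σ ∷ []) ≡ jacobsthal n
theorem3p18 n σ (inj₁ refl) = d≡jacobsthal pattern132 extremalCoding n
theorem3p18 n σ (inj₂ refl) = d≡jacobsthal pattern231 layeredCoding n
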